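{- For every integer $n \geq 1$, let $B_n^{(3)}$ be the triangular book graph with vertex set $\{a, b, c_1, \dots, c_n\}$ and edge set $\{ab\} \cup \{ac_i, bc_i : 1 \leq i \leq n\}$ (order $n+2$, size $2n+1$). Then $$s\left(B_n^{(3)}\right) = \begin{cases} 3, & \text{if } n = 1, \\ \left\lceil \frac{n+1}{2} \right\rceil, & \text{if } n \geq 2. \end{cases}$$
   Context: The triangular book graph $B_n^{(3)}$ consists of $n$ triangles sharing a common edge $ab$. For a simple graph $G$, an edge $k$-labeling $f: E(G) \to \{1, 2, \dots, k\}$ is a vertex irregular edge $k$-labeling (irregular assignment) if the vertex weights $w_f(u) = \sum_{uv \in E(G)} f(uv)$ are pairwise distinct over all vertices $u$ of $G$. The irregularity strength $s(G)$ is the minimum $k$ for which $G$ admits a vertex irregular edge $k$-labeling, and $s(G) = \infty$ if no such labeling exists. -}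

module Defs where

open import Data.Nat using (ℕ; zero; suc; _+_; _*_; _≤_; _<_; _/_)
open import Data.Fin using (Fin; zero; suc; join; splitAt; _≟_)
import Data.Fin as F
open import Data.Product using (_×_; _,_; proj₁; proj₂; Σ; ∃-syntax)
open import Data.Sum using (_⊎_; inj₁; inj₂)
open import Data.Vec.Functional using (foldr)
open import Relation.Binary.PropositionalEquality using (_≡_; _≢_)
open import Relation.Nullary using (¬_; yes; no)
open import Data.Bool using (if_then_else_)
open import Relation.Nullary.Decidable using (⌊_⌋)
open import Function.Definitions using (Injective)

record SimpleGraph : Set where
  field
    V : ℕ
    E : ℕ
    ends : Fin E → Fin V × Fin V
    loopless : ∀ e → proj₁ (ends e) ≢ proj₂ (ends e)
    noMulti : ∀ e e' →
      (proj₁ (ends e) ≡ proj₁ (ends e') × proj₂ (ends e) ≡ proj₂ (ends e')) ⊎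
      (proj₁ (ends e) ≡ proj₂ (ends e') × proj₂ (ends e) ≡ proj₁ (ends e')) →
      e ≡ e'
open SimpleGraph public

Σ[<_] : ∀ {m} → (Fin m → ℕ) → ℕ
Σ[< f ] = foldr _+_ 0 f

incident : (G : SimpleGraph) → Fin (V G) → Fin (E G) → Set
incident G u e = (u ≡ proj₁ (ends G e)) ⊎ (u ≡ proj₂ (ends G e))

contrib : (G : SimpleGraph) → (Fin (E G) → ℕ) → Fin (V G) → Fin (E G) → ℕ
contrib G f u e with u ≟ proj₁ (ends G e) | u ≟ proj₂ (ends G e)
... | yes _ | _     = f e
... | no _  | yes _ = f e
... | no _  | no _  = 0

weight : (G : SimpleGraph) → (Fin (E G) → ℕ) → Fin (V G) → ℕ
weight G f u = Σ[< contrib G f u ]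

IsEdgeLabeling : (G : SimpleGraph) → ℕ → (Fin (E G) → ℕ) → Set
IsEdgeLabeling G k f = ∀ e → 1 ≤ f e × f e ≤ k

IsIrregularLabeling : (G : SimpleGraph) → ℕ → (Fin (E G) → ℕ) → Set
IsIrregularLabeling G k f = IsEdgeLabeling G k f × Injective _≡_ _≡_ (weight G f)

HasIrregularLabeling : SimpleGraph → ℕ → Set
HasIrregularLabeling G k = ∃[ f ] IsIrregularLabeling G k f

IrregularityStrength≡ : SimpleGraph → ℕ → Set
IrregularityStrength≡ G s =
  HasIrregularLabeling G s × (∀ k → k < s → ¬ HasIrregularLabeling G k)

-- Vertices Fin (2 + n): zero = a, suc zero = b, suc (suc i) = c_{i+1}.
-- Edges Fin (1 + (n + n)): zero = ab; suc (F.inject+ n i) = a c_i;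
-- suc (F.raise n i) = b c_i.
bookEnds : (n : ℕ) → Fin (1 + (n + n)) → Fin (2 + n) × Fin (2 + n)
bookEnds n zero = zero , suc zero
bookEnds n (suc e) with splitAt n e
... | inj₁ i = zero , suc (suc i)
... | inj₂ i = suc zero , suc (suc i)

private
  open import Relation.Binary.PropositionalEquality using (refl; cong; sym; trans)
  open import Data.Fin.Properties using (suc-injective; splitAt⁻¹-↑ˡ; splitAt⁻¹-↑ʳ)
  open import Data.Sum.Properties using (inj₁-injective; inj₂-injective)

  data View (n : ℕ) : Fin (1 + (n + n)) → Set where
    vab : View n zero
    vac : ∀ {e} i → splitAt n e ≡ inj₁ i → View n (suc e)
    vbc : ∀ {e} i → splitAt n e ≡ inj₂ i → View n (suc e)

  view : ∀ n e → View n e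
  view n zero = vab
  view n (suc e) with splitAt n e in eq
  ... | inj₁ i = vac i eq
  ... | inj₂ i = vbc i eq

  ends-ac : ∀ n {e} i → splitAt n e ≡ inj₁ i → bookEnds n (suc e) ≡ (zero , suc (suc i))
  ends-ac n {e} i eq with splitAt n e
  ends-ac n {e} i refl | .(inj₁ i) = refl

  ends-bc : ∀ n {e} i → splitAt n e ≡ inj₂ i → bookEnds n (suc e) ≡ (suc zero , suc (suc i))
  ends-bc n {e} i eq with splitAt n e
  ends-bc n {e} i refl | .(inj₂ i) = refl

bookLoopless : ∀ n e → proj₁ (bookEnds n e) ≢ proj₂ (bookEnds n e)
bookLoopless n e with view n e
... | vab = λ ()
... | vac i eq rewrite ends-ac n i eq = λ ()
... | vbc i eq rewrite ends-bc n i eq = λ ()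

bookNoMulti : ∀ n e e' →
  (proj₁ (bookEnds n e) ≡ proj₁ (bookEnds n e') × proj₂ (bookEnds n e) ≡ proj₂ (bookEnds n e')) ⊎
  (proj₁ (bookEnds n e) ≡ proj₂ (bookEnds n e') × proj₂ (bookEnds n e) ≡ proj₁ (bookEnds n e')) →
  e ≡ e'
bookNoMulti n e e' h with view n e | view n e'
... | vab | vab = refl
... | vab | vac j q rewrite ends-ac n j q with h
...   | inj₁ (_ , ())
...   | inj₂ (() , _)
bookNoMulti n e e' h | vab | vbc j q rewrite ends-bc n j q with h
...   | inj₁ (() , _)
...   | inj₂ (() , _)
bookNoMulti n e e' h | vac i p | vab rewrite ends-ac n i p with h
...   | inj₁ (_ , ())
...   | inj₂ (() , _)
bookNoMulti n e e' h | vbc i p | vab rewrite ends-bc n i p with h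
...   | inj₁ (() , _)
...   | inj₂ (_ , ())
bookNoMulti n (suc e) (suc e') h | vac i p | vac j q rewrite ends-ac n i p | ends-ac n j q with h
...   | inj₁ (_ , r) = cong suc (trans (sym (splitAt⁻¹-↑ˡ p))
          (trans (cong (λ x → x Data.Fin.↑ˡ n) (suc-injective (suc-injective r))) (splitAt⁻¹-↑ˡ q)))
...   | inj₂ (() , _)
bookNoMulti n (suc e) (suc e') h | vac i p | vbc j q rewrite ends-ac n i p | ends-bc n j q with h
...   | inj₁ (() , _)
...   | inj₂ (() , _)
bookNoMulti n (suc e) (suc e') h | vbc i p | vac j q rewrite ends-bc n i p | ends-ac n j q with h
...   | inj₁ (() , _)
...   | inj₂ (() , _)
bookNoMulti n (suc e) (suc e') h | vbc i p | vbc j q rewrite ends-bc n i p | ends-bc n j q with h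
...   | inj₁ (_ , r) = cong suc (trans (sym (splitAt⁻¹-↑ʳ p))
          (trans (cong (n Data.Fin.↑ʳ_) (suc-injective (suc-injective r))) (splitAt⁻¹-↑ʳ q)))
...   | inj₂ (() , _)

Book : ℕ → SimpleGraph
Book n = record
  { V = 2 + n ; E = 1 + (n + n) ; ends = bookEnds n
  ; loopless = bookLoopless n ; noMulti = bookNoMulti n }

⌈_/2⌉ : ℕ → ℕ
⌈ m /2⌉ = (m + 1) / 2

bookStrengthValue : ℕ → ℕ
bookStrengthValue 1 = 3
bookStrengthValue n = ⌈ n + 1 /2⌉

-- The weight of the page vertex cᵢ is f(acᵢ) + f(bcᵢ) ∈ [2, 2k], and these n weights must be
-- distinct, so n ≤ 2k − 1, i.e. k ≥ ⌈(n+1)/2⌉. For n = 1 the weights f(ab) + f(ac),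
-- f(ab) + f(bc) and f(ac) + f(bc) are pairwise distinct only if the three labels are, so
-- k ≥ 3, and the labels 3, 2, 1 on ab, ac, bc work. For n ≥ 2, labelling the edges of
-- page i (counted from 0) by ⌈i/2⌉ + 1 and ⌊i/2⌋ + 1 gives the pages the weights 2, …, n + 1,
-- and labelling ab by k then makes b heavier than every page and a heavier than b.
module Submission where

open import Defs hiding (⌈_/2⌉)
open import Data.Nat
  using (ℕ; zero; suc; _+_; _≤_; _<_; _≥_; z≤n; s≤s; s≤s⁻¹; pred; ⌊_/2⌋; ⌈_/2⌉; >-nonZero)
open import Data.Nat.Properties
open import Data.Nat.DivMod using (_/_; m/n≡1+[m∸n]/n)
open import Algebra.Properties.Monoid.Sum +-0-monoid using (sum-cong-≗)
open import Data.Fin using (Fin; zero; suc; toℕ; _↑ˡ_; _↑ʳ_; splitAt)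
open import Data.Fin.Properties
  using (splitAt-↑ˡ; splitAt-↑ʳ; toℕ-injective; toℕ<n; fromℕ<-injective; injective⇒≤)
  renaming (suc-injective to fsuc-injective)
open import Data.Product using (_×_; _,_; proj₁; proj₂; uncurry)
open import Data.Sum using (inj₁; inj₂; [_,_]′)
open import Data.Empty using (⊥-elim)
open import Function using (_∘_)
open import Function.Definitions using (Injective)
open import Relation.Binary.PropositionalEquality
open import Relation.Nullary using (¬_; yes; no)

m+n≡2+pred[m]+pred[n] : ∀ {x y} → 1 ≤ x → 1 ≤ y → x + y ≡ 2 + (pred x + pred y)
m+n≡2+pred[m]+pred[n] {suc x} {suc y} _ _ = cong suc (+-suc x y)

1+⌈n/2⌉+1+⌊n/2⌋≡2+n : ∀ n → suc ⌈ n /2⌉ + suc ⌊ n /2⌋ ≡ 2 + n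
1+⌈n/2⌉+1+⌊n/2⌋≡2+n n = cong suc (begin
  ⌈ n /2⌉ + suc ⌊ n /2⌋   ≡⟨ +-suc ⌈ n /2⌉ ⌊ n /2⌋ ⟩
  suc (⌈ n /2⌉ + ⌊ n /2⌋) ≡⟨ cong suc (+-comm ⌈ n /2⌉ ⌊ n /2⌋) ⟩
  suc (⌊ n /2⌋ + ⌈ n /2⌉) ≡⟨ cong suc (⌊n/2⌋+⌈n/2⌉≡n n) ⟩
  suc n                   ∎)
  where open ≡-Reasoning

⌊n/2⌋+⌊n/2⌋≤n : ∀ n → ⌊ n /2⌋ + ⌊ n /2⌋ ≤ n
⌊n/2⌋+⌊n/2⌋≤n n =
  subst (⌊ n /2⌋ + ⌊ n /2⌋ ≤_) (⌊n/2⌋+⌈n/2⌉≡n n) (+-monoʳ-≤ ⌊ n /2⌋ (⌊n/2⌋≤⌈n/2⌉ n))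

n/2≡⌊n/2⌋ : ∀ n → n / 2 ≡ ⌊ n /2⌋
n/2≡⌊n/2⌋ zero          = refl
n/2≡⌊n/2⌋ (suc zero)    = refl
n/2≡⌊n/2⌋ (suc (suc n)) = trans (m/n≡1+[m∸n]/n {2 + n} (s≤s (s≤s z≤n))) (cong suc (n/2≡⌊n/2⌋ n))

Σ-splitAt : ∀ m k (g : Fin (m + k) → ℕ) →
  Σ[< g ] ≡ Σ[< g ∘ (_↑ˡ k) ] + Σ[< g ∘ (m ↑ʳ_) ]
Σ-splitAt zero    k g = refl
Σ-splitAt (suc m) k g =
  trans (cong (g zero +_) (Σ-splitAt m k (g ∘ suc))) (sym (+-assoc (g zero) _ _))

Σ-zero : ∀ {n} (g : Fin n → ℕ) → (∀ i → g i ≡ 0) → Σ[< g ] ≡ 0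
Σ-zero {zero}  g g≡0 = refl
Σ-zero {suc n} g g≡0 = cong₂ _+_ (g≡0 zero) (Σ-zero (g ∘ suc) (g≡0 ∘ suc))

Σ-single : ∀ {n} (g : Fin n → ℕ) i → (∀ j → j ≢ i → g j ≡ 0) → Σ[< g ] ≡ g i
Σ-single g zero g≡0 =
  trans (cong (g zero +_) (Σ-zero (g ∘ suc) (λ j → g≡0 (suc j) λ ()))) (+-identityʳ _)
Σ-single g (suc i) g≡0 =
  cong₂ _+_ (g≡0 zero λ ()) (Σ-single (g ∘ suc) i (λ j j≢i → g≡0 (suc j) (j≢i ∘ fsuc-injective)))

Σ-mono-≤ : ∀ {n} {g h : Fin n → ℕ} → (∀ i → g i ≤ h i) → Σ[< g ] ≤ Σ[< h ]
Σ-mono-≤ {zero}  g≤h = z≤n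
Σ-mono-≤ {suc n} g≤h = +-mono-≤ (g≤h zero) (Σ-mono-≤ (g≤h ∘ suc))

Σ-mono-< : ∀ {n} {g h : Fin n → ℕ} → (∀ i → g i ≤ h i) → ∀ i → g i < h i → Σ[< g ] < Σ[< h ]
Σ-mono-< g≤h zero    g<h = +-mono-<-≤ g<h (Σ-mono-≤ (g≤h ∘ suc))
Σ-mono-< g≤h (suc i) g<h = +-mono-≤-< (g≤h zero) (Σ-mono-< (g≤h ∘ suc) i g<h)

n≤Σ : ∀ {n} (g : Fin n → ℕ) → (∀ i → 1 ≤ g i) → n ≤ Σ[< g ]
n≤Σ {zero}  g 1≤g = z≤n
n≤Σ {suc n} g 1≤g = +-mono-≤ (1≤g zero) (n≤Σ (g ∘ suc) (1≤g ∘ suc))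

bounded-injection⇒≤ : ∀ {n m} (g : Fin n → ℕ) (g<m : ∀ i → g i < m) →
  Injective _≡_ _≡_ g → n ≤ m
bounded-injection⇒≤ g g<m g-inj =
  injective⇒≤ (λ eq → g-inj (fromℕ<-injective _ _ (g<m _) (g<m _) eq))

module _ (G : SimpleGraph) (f : Fin (E G) → ℕ) (u : Fin (V G)) {e x y} (ends≡ : ends G e ≡ (x , y)) where

  contrib-off : u ≢ x → u ≢ y → contrib G f u e ≡ 0
  contrib-off u≢x u≢y with u Data.Fin.≟ proj₁ (ends G e) | u Data.Fin.≟ proj₂ (ends G e)
  ... | yes u≡ | _      = ⊥-elim (u≢x (trans u≡ (cong proj₁ ends≡)))
  ... | no _   | yes u≡ = ⊥-elim (u≢y (trans u≡ (cong proj₂ ends≡)))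
  ... | no _   | no _   = refl

  contrib-on₁ : u ≡ x → contrib G f u e ≡ f e
  contrib-on₁ u≡x with u Data.Fin.≟ proj₁ (ends G e)
  ... | yes _ = refl
  ... | no u≢ = ⊥-elim (u≢ (trans u≡x (cong proj₁ (sym ends≡))))

  contrib-on₂ : u ≡ y → contrib G f u e ≡ f e
  contrib-on₂ u≡y with u Data.Fin.≟ proj₁ (ends G e) | u Data.Fin.≟ proj₂ (ends G e)
  ... | yes _ | _     = refl
  ... | no _  | yes _ = refl
  ... | no _  | no u≢ = ⊥-elim (u≢ (trans u≡y (cong proj₂ (sym ends≡))))

pattern a = zero
pattern b = suc zero
pattern c i = suc (suc i)

c-injective : ∀ {n} {i j : Fin n} → c i ≡ c j → i ≡ j
c-injective = fsuc-injective ∘ fsuc-injective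

pattern ab = zero

injective-by-layers : ∀ {n} (w : Fin (2 + n) → ℕ) → w b < w a → (∀ i → w (c i) < w b) →
  Injective _≡_ _≡_ (λ i → w (c i)) → Injective _≡_ _≡_ w
injective-by-layers w b<a c<b c-inj {a}   {a}   _  = refl
injective-by-layers w b<a c<b c-inj {a}   {b}   eq = ⊥-elim (<-irrefl (sym eq) b<a)
injective-by-layers w b<a c<b c-inj {a}   {c j} eq = ⊥-elim (<-irrefl (sym eq) (<-trans (c<b j) b<a))
injective-by-layers w b<a c<b c-inj {b}   {a}   eq = ⊥-elim (<-irrefl eq b<a)
injective-by-layers w b<a c<b c-inj {b}   {b}   _  = refl
injective-by-layers w b<a c<b c-inj {b}   {c j} eq = ⊥-elim (<-irrefl (sym eq) (c<b j))
injective-by-layers w b<a c<b c-inj {c i} {a}   eq = ⊥-elim (<-irrefl eq (<-trans (c<b i) b<a))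
injective-by-layers w b<a c<b c-inj {c i} {b}   eq = ⊥-elim (<-irrefl eq (c<b i))
injective-by-layers w b<a c<b c-inj {c i} {c j} eq = cong (λ i → c i) (c-inj eq)

module BookGraph (n : ℕ) where

  ac bc : Fin n → Fin (1 + (n + n))
  ac i = suc (i ↑ˡ n)
  bc i = suc (n ↑ʳ i)

  ends-ac : ∀ i → ends (Book n) (ac i) ≡ (a , c i)
  ends-ac i rewrite splitAt-↑ˡ n i n = refl

  ends-bc : ∀ i → ends (Book n) (bc i) ≡ (b , c i)
  ends-bc i rewrite splitAt-↑ʳ n n i = refl

  module _ (f : Fin (1 + (n + n)) → ℕ) where

    private
      contribBook : Fin (2 + n) → Fin (1 + (n + n)) → ℕ
      contribBook = contrib (Book n) f

    weight-split : ∀ u → weight (Book n) f u ≡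
      contribBook u ab + (Σ[< contribBook u ∘ ac ] + Σ[< contribBook u ∘ bc ])
    weight-split u = cong (contribBook u ab +_) (Σ-splitAt n n (contribBook u ∘ suc))

    weight-a : weight (Book n) f a ≡ f ab + Σ[< f ∘ ac ]
    weight-a = begin
      weight (Book n) f a                                      ≡⟨ weight-split a ⟩
      f ab + (Σ[< contribBook a ∘ ac ] + Σ[< contribBook a ∘ bc ])
        ≡⟨ cong (f ab +_) (cong₂ _+_ (sum-cong-≗ on-ac) (Σ-zero _ off-bc)) ⟩
      f ab + (Σ[< f ∘ ac ] + 0)                                ≡⟨ cong (f ab +_) (+-identityʳ _) ⟩
      f ab + Σ[< f ∘ ac ]                                      ∎
      where
      open ≡-Reasoning
      on-ac : ∀ j → contribBook a (ac j) ≡ f (ac j)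
      on-ac j = contrib-on₁ (Book n) f a (ends-ac j) refl
      off-bc : ∀ j → contribBook a (bc j) ≡ 0
      off-bc j = contrib-off (Book n) f a (ends-bc j) (λ ()) (λ ())

    weight-b : weight (Book n) f b ≡ f ab + Σ[< f ∘ bc ]
    weight-b = begin
      weight (Book n) f b                                      ≡⟨ weight-split b ⟩
      f ab + (Σ[< contribBook b ∘ ac ] + Σ[< contribBook b ∘ bc ])
        ≡⟨ cong (f ab +_) (cong₂ _+_ (Σ-zero _ off-ac) (sum-cong-≗ on-bc)) ⟩
      f ab + Σ[< f ∘ bc ]                                      ∎
      where
      open ≡-Reasoning
      off-ac : ∀ j → contribBook b (ac j) ≡ 0
      off-ac j = contrib-off (Book n) f b (ends-ac j) (λ ()) (λ ())
      on-bc : ∀ j → contribBook b (bc j) ≡ f (bc j)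
      on-bc j = contrib-on₁ (Book n) f b (ends-bc j) refl

    weight-c : ∀ i → weight (Book n) f (c i) ≡ f (ac i) + f (bc i)
    weight-c i = begin
      weight (Book n) f (c i)                                    ≡⟨ weight-split (c i) ⟩
      0 + (Σ[< contribBook (c i) ∘ ac ] + Σ[< contribBook (c i) ∘ bc ])
        ≡⟨ cong₂ _+_ (Σ-single _ i off-ac) (Σ-single _ i off-bc) ⟩
      contribBook (c i) (ac i) + contribBook (c i) (bc i)
        ≡⟨ cong₂ _+_ (contrib-on₂ (Book n) f (c i) (ends-ac i) refl)
                     (contrib-on₂ (Book n) f (c i) (ends-bc i) refl) ⟩
      f (ac i) + f (bc i)                                        ∎
      where
      open ≡-Reasoning
      off-ac : ∀ j → j ≢ i → contribBook (c i) (ac j) ≡ 0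
      off-ac j j≢i = contrib-off (Book n) f (c i) (ends-ac j) (λ ()) (j≢i ∘ sym ∘ c-injective)
      off-bc : ∀ j → j ≢ i → contribBook (c i) (bc j) ≡ 0
      off-bc j j≢i = contrib-off (Book n) f (c i) (ends-bc j) (λ ()) (j≢i ∘ sym ∘ c-injective)

  bookLabeling : ℕ → (Fin n → ℕ) → (Fin n → ℕ) → Fin (1 + (n + n)) → ℕ
  bookLabeling x α β ab      = x
  bookLabeling x α β (suc e) = [ α , β ]′ (splitAt n e)

  module _ {x : ℕ} {α β : Fin n → ℕ} where

    bookLabeling-isEdgeLabeling : ∀ {k} → 1 ≤ x × x ≤ k →
      (∀ i → 1 ≤ α i × α i ≤ k) → (∀ i → 1 ≤ β i × β i ≤ k) →
      IsEdgeLabeling (Book n) k (bookLabeling x α β)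
    bookLabeling-isEdgeLabeling x-ok α-ok β-ok ab = x-ok
    bookLabeling-isEdgeLabeling x-ok α-ok β-ok (suc e) with splitAt n e
    ... | inj₁ i = α-ok i
    ... | inj₂ i = β-ok i

    bookLabeling-weight-injective : Σ[< β ] < Σ[< α ] → (∀ i → α i + β i < x + Σ[< β ]) →
      Injective _≡_ _≡_ (λ i → α i + β i) → Injective _≡_ _≡_ (weight (Book n) (bookLabeling x α β))
    bookLabeling-weight-injective Σβ<Σα c<b c-inj =
      injective-by-layers w
        (subst₂ _<_ (sym w-b) (sym w-a) (+-monoʳ-< x Σβ<Σα))
        (λ i → subst₂ _<_ (sym (w-c i)) (sym w-b) (c<b i))
        (λ eq → c-inj (trans (sym (w-c _)) (trans eq (w-c _))))
      where
      f : Fin (1 + (n + n)) → ℕ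
      f = bookLabeling x α β
      w : Fin (2 + n) → ℕ
      w = weight (Book n) f
      on-ac : ∀ i → f (ac i) ≡ α i
      on-ac i = cong [ α , β ]′ (splitAt-↑ˡ n i n)
      on-bc : ∀ i → f (bc i) ≡ β i
      on-bc i = cong [ α , β ]′ (splitAt-↑ʳ n n i)
      w-a : w a ≡ x + Σ[< α ]
      w-a = trans (weight-a f) (cong (x +_) (sum-cong-≗ on-ac))
      w-b : w b ≡ x + Σ[< β ]
      w-b = trans (weight-b f) (cong (x +_) (sum-cong-≗ on-bc))
      w-c : ∀ i → w (c i) ≡ α i + β i
      w-c i = trans (weight-c f i) (cong₂ _+_ (on-ac i) (on-bc i))

  book-irregular⇒n<k+k : ∀ {k} → HasIrregularLabeling (Book n) k → n < k + k
  book-irregular⇒n<k+k {zero} (f , isLabeling , _) = ⊥-elim (1+n≰n (uncurry ≤-trans (isLabeling ab)))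
  book-irregular⇒n<k+k {suc k} (f , isLabeling , w-inj) =
    s≤s (subst (n ≤_) (sym (+-suc k k)) (bounded-injection⇒≤ g g<1+k+k g-inj))
    where
    g : Fin n → ℕ
    g i = pred (f (ac i)) + pred (f (bc i))
    g<1+k+k : ∀ i → g i < suc (k + k)
    g<1+k+k i = s≤s (+-mono-≤ (pred-mono-≤ (proj₂ (isLabeling (ac i))))
                              (pred-mono-≤ (proj₂ (isLabeling (bc i)))))
    w-c : ∀ i → weight (Book n) f (c i) ≡ 2 + g i
    w-c i = trans (weight-c f i) (m+n≡2+pred[m]+pred[n] (proj₁ (isLabeling (ac i))) (proj₁ (isLabeling (bc i))))
    g-inj : Injective _≡_ _≡_ g
    g-inj eq = c-injective (w-inj (trans (w-c _) (trans (cong (2 +_) eq) (sym (w-c _)))))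

book₁-irregular : HasIrregularLabeling (Book 1) 3
book₁-irregular =
  bookLabeling 3 (λ _ → 2) (λ _ → 1) ,
  bookLabeling-isEdgeLabeling (s≤s z≤n , ≤-refl) (λ _ → s≤s z≤n , s≤s (s≤s z≤n)) (λ _ → ≤-refl , s≤s z≤n) ,
  bookLabeling-weight-injective ≤-refl (λ _ → ≤-refl) λ { {zero} {zero} _ → refl }
  where open BookGraph 1

book₁-labels-distinct : ∀ {k f} → IsIrregularLabeling (Book 1) k f → Injective _≡_ _≡_ f
book₁-labels-distinct {f = f} (_ , w-inj) = distinct _ _
  where
  open BookGraph 1
  open ≡-Reasoning
  w : Fin 3 → ℕ
  w = weight (Book 1) f
  ab≢ac : f ab ≢ f (ac zero)
  ab≢ac eq with w-inj {b} {c zero} (begin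
    w b                        ≡⟨ weight-b f ⟩
    f ab + (f (bc zero) + 0)   ≡⟨ cong₂ _+_ eq (+-identityʳ _) ⟩
    f (ac zero) + f (bc zero)  ≡⟨ weight-c f zero ⟨
    w (c zero)                 ∎)
  ... | ()
  ab≢bc : f ab ≢ f (bc zero)
  ab≢bc eq with w-inj {a} {c zero} (begin
    w a                        ≡⟨ weight-a f ⟩
    f ab + (f (ac zero) + 0)   ≡⟨ cong₂ _+_ eq (+-identityʳ _) ⟩
    f (bc zero) + f (ac zero)  ≡⟨ +-comm (f (bc zero)) (f (ac zero)) ⟩
    f (ac zero) + f (bc zero)  ≡⟨ weight-c f zero ⟨
    w (c zero)                 ∎)
  ... | ()
  ac≢bc : f (ac zero) ≢ f (bc zero)
  ac≢bc eq with w-inj {a} {b} (trans (weight-a f) (trans (cong (λ y → f ab + (y + 0)) eq) (sym (weight-b f))))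
  ... | ()
  distinct : ∀ e e′ → f e ≡ f e′ → e ≡ e′
  distinct zero             zero             _  = refl
  distinct zero             (suc zero)       eq = ⊥-elim (ab≢ac eq)
  distinct zero             (suc (suc zero)) eq = ⊥-elim (ab≢bc eq)
  distinct (suc zero)       zero             eq = ⊥-elim (ab≢ac (sym eq))
  distinct (suc zero)       (suc zero)       _  = refl
  distinct (suc zero)       (suc (suc zero)) eq = ⊥-elim (ac≢bc eq)
  distinct (suc (suc zero)) zero             eq = ⊥-elim (ab≢bc (sym eq))
  distinct (suc (suc zero)) (suc zero)       eq = ⊥-elim (ac≢bc (sym eq))
  distinct (suc (suc zero)) (suc (suc zero)) _  = refl

book₁-irregular⇒3≤k : ∀ {k} → HasIrregularLabeling (Book 1) k → 3 ≤ k
book₁-irregular⇒3≤k (f , isLabeling , w-inj) =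
  bounded-injection⇒≤ (pred ∘ f) (λ e → pred-label<k (isLabeling e))
    (λ {e} {e′} eq → book₁-labels-distinct (isLabeling , w-inj)
      (pred-injective {{>-nonZero (proj₁ (isLabeling e))}} {{>-nonZero (proj₁ (isLabeling e′))}} eq))
  where
  pred-label<k : ∀ {x k} → 1 ≤ x × x ≤ k → pred x < k
  pred-label<k (s≤s z≤n , x≤k) = x≤k

bookStrengthValue-2+n : ∀ n → bookStrengthValue (2 + n) ≡ 2 + ⌊ n /2⌋
bookStrengthValue-2+n n =
  trans (n/2≡⌊n/2⌋ (2 + n + 1 + 1)) (cong ⌊_/2⌋ (trans (+-assoc (2 + n) 1 1) (+-comm (2 + n) 2)))

book-irregular-2+n : ∀ n → HasIrregularLabeling (Book (2 + n)) (2 + ⌊ n /2⌋)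
book-irregular-2+n n =
  bookLabeling K α β ,
  bookLabeling-isEdgeLabeling (s≤s z≤n , ≤-refl) (λ i → s≤s z≤n , α≤K i)
    (λ i → s≤s z≤n , ≤-trans (β≤α i) (α≤K i)) ,
  bookLabeling-weight-injective (Σ-mono-< β≤α (suc zero) ≤-refl) c<b
    (λ eq → toℕ-injective (suc-injective (suc-injective
      (trans (sym (α+β≡2+i _)) (trans eq (α+β≡2+i _))))))
  where
  open BookGraph (2 + n)
  K : ℕ
  K = 2 + ⌊ n /2⌋
  α β : Fin (2 + n) → ℕ
  α i = suc ⌈ toℕ i /2⌉
  β i = suc ⌊ toℕ i /2⌋
  α≤K : ∀ i → α i ≤ K
  α≤K i = s≤s (⌈n/2⌉-mono (s≤s⁻¹ (toℕ<n i)))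
  β≤α : ∀ i → β i ≤ α i
  β≤α i = s≤s (⌊n/2⌋≤⌈n/2⌉ (toℕ i))
  α+β≡2+i : ∀ i → α i + β i ≡ 2 + toℕ i
  α+β≡2+i i = 1+⌈n/2⌉+1+⌊n/2⌋≡2+n (toℕ i)
  c<b : ∀ i → α i + β i < K + Σ[< β ]
  c<b i = subst (_< K + Σ[< β ]) (sym (α+β≡2+i i))
    (+-mono-≤-< (s≤s (s≤s z≤n)) (<-≤-trans (toℕ<n i) (n≤Σ β (λ _ → s≤s z≤n))))

book-not-irregular-2+n : ∀ n k → k < 2 + ⌊ n /2⌋ → ¬ HasIrregularLabeling (Book (2 + n)) k
book-not-irregular-2+n n k k<K irregular = <⇒≱ (book-irregular⇒n<k+k irregular) (begin
  k + k                             ≤⟨ +-mono-≤ k≤1+⌊n/2⌋ k≤1+⌊n/2⌋ ⟩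
  suc ⌊ n /2⌋ + suc ⌊ n /2⌋         ≡⟨ cong suc (+-suc ⌊ n /2⌋ ⌊ n /2⌋) ⟩
  2 + (⌊ n /2⌋ + ⌊ n /2⌋)           ≤⟨ +-monoʳ-≤ 2 (⌊n/2⌋+⌊n/2⌋≤n n) ⟩
  2 + n                             ∎)
  where
  open BookGraph (2 + n)
  open ≤-Reasoning
  k≤1+⌊n/2⌋ : k ≤ suc ⌊ n /2⌋
  k≤1+⌊n/2⌋ = s≤s⁻¹ k<K

theorem1 : (n : ℕ) → n ≥ 1 →
    IrregularityStrength≡ (Book n) (bookStrengthValue n)
theorem1 (suc zero)    _ = book₁-irregular , λ k k<3 → <⇒≱ k<3 ∘ book₁-irregular⇒3≤k
theorem1 (suc (suc n)) _ = subst (IrregularityStrength≡ (Book (2 + n))) (sym (bookStrengthValue-2+n n))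
  (book-irregular-2+n n , book-not-irregular-2+n n)
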